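{- For any positive integers $n,k$ with $n\ge 2^{k/2}$, there exist an $n$-vertex directed graph $G$ and vertices $s,t\in V(G)$ such that every $s$-$t$ $k$-FT connectivity preserver of $G$ has $\Omega(n2^{k/2})$ edges.
   Context: A subgraph $H$ of a directed graph $G$ (with $V(H)=V(G)$, $E(H)\subseteq E(G)$) is an $s$-$t$ $k$-FT connectivity preserver of $G$ if for every edge set $F\subseteq E(G)$ with $|F|\le k$, the vertices $s$ and $t$ are strongly connected in $H-F$ if and only if they are strongly connected in $G-F$. -}

module Defs where

open import Data.Nat using (ℕ)
open import Data.Fin using (Fin)
open import Data.Product using (_×_; _,_)
open import Data.List using (List; length)
open import Data.List.Membership.Propositional using (_∈_; _∉_)
open import Data.List.Relation.Unary.Unique.Propositional using (Unique)
open import Data.List.Relation.Unary.All using (All)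

Edge : ℕ → Set
Edge n = Fin n × Fin n

record Digraph (n : ℕ) : Set where
  constructor digraph
  field
    edges  : List (Edge n)
    unique : Unique edges
open Digraph public

∣E∣ : ∀ {n} → Digraph n → ℕ
∣E∣ G = length (edges G)

_⊑_ : ∀ {n} → Digraph n → Digraph n → Set
H ⊑ G = All (λ e → e ∈ edges G) (edges H)

data Reach {n : ℕ} (G : Digraph n) (F : List (Edge n)) : Fin n → Fin n → Set where
  here : ∀ {u} → Reach G F u u
  step : ∀ {u w v} → (u , w) ∈ edges G → (u , w) ∉ F → Reach G F w v → Reach G F u v

StronglyConnected : ∀ {n} → Digraph n → List (Edge n) → Fin n → Fin n → Set
StronglyConnected G F s t = Reach G F s t × Reach G F t s

record FaultSet {n : ℕ} (G : Digraph n) (k : ℕ) : Set where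
  constructor faultSet
  field
    fedges  : List (Edge n)
    funique : Unique fedges
    fsub    : All (λ e → e ∈ edges G) fedges
    fsize   : length fedges Data.Nat.≤ k
open FaultSet public

FTPreserver : ∀ {n} → ℕ → Digraph n → Fin n → Fin n → Digraph n → Set
FTPreserver k G s t H =
  H ⊑ G ×
  ((F : FaultSet G k) →
     (StronglyConnected H (fedges F) s t → StronglyConnected G (fedges F) s t) ×
     (StronglyConnected G (fedges F) s t → StronglyConnected H (fedges F) s t))

{-# OPTIONS --safe #-}

-- G is a cycle of m ≈ n / 2^(h+2) blocks with h ≈ k/2 − 2, running from s through every block to t
-- and back to s. A block is an out-tree and an in-tree, both complete binary of height h, joined
-- by all 4^h arcs from out-leaves to in-leaves. For such an arc ℓ → r, deleting the ≤ 2h tree arcs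
-- that leave the root–ℓ path or enter the r–root path keeps s and t strongly connected (through ℓ → r),
-- yet leaves ℓ → r as the only arc out of a vertex set containing s but not t. So every preserver
-- keeps all m·4^h leaf arcs, and m·4^h = Ω(n·2^(k/2)).

module Submission where

open import Defs
open import Data.Bool using (Bool; true; false; not)
import Data.Bool.Properties as Bool
open import Data.Fin as Fin using (Fin; zero; suc; toℕ; fromℕ; fromℕ<; inject≤; combine; quotient; remainder)
open import Data.Fin.Properties
  using ( _≟_; 2↔Bool; *↔×; combine-injective; suc-injective; inject≤-injective; toℕ-injective; toℕ-fromℕ<
        ; fromℕ-def; ≤fromℕ; ≤∧≢⇒<; injective⇒≤)
open import Data.List
  using (List; []; _∷_; map; _++_; length; filter; cartesianProduct; cartesianProductWith; deduplicate; lookup; allFin)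
open import Data.List.Membership.Propositional using (_∈_; _∉_)
open import Data.List.Membership.Propositional.Properties
  using ( ∈-map⁺; ∈-map⁻; ∈-++⁺ˡ; ∈-++⁺ʳ; ∈-++⁻; ∈-filter⁺; ∈-filter⁻; ∈-cartesianProduct⁺; ∈-cartesianProductWith⁺
        ; ∈-deduplicate⁺; ∈-deduplicate⁻; ∈-allFin)
open import Data.List.Membership.DecPropositional using (_∈?_)
open import Data.List.Properties using (length-map; length-++; length-deduplicate)
open import Data.List.Relation.Unary.Any using (here; there)
open import Data.List.Relation.Unary.Any.Properties using (lookup-index)
import Data.List.Relation.Unary.All as All
open import Data.List.Relation.Unary.Unique.DecPropositional.Properties using (deduplicate-!)
open import Data.Nat as ℕ using (ℕ; zero; suc; _+_; _*_; _^_; _≤_; _<_; z≤n; s≤s; _/_; _%_; NonZero; >-nonZero)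
open import Data.Nat.Properties
  using ( ≤-refl; ≤-trans; ≤-reflexive; <⇒≤; <⇒≱; ≮⇒≥; ≰⇒>; m≤n⇒m<n∨m≡n; n≤1+n; m≤m+n; m≤n+m; m≤n*m
        ; +-suc; +-identityʳ; *-suc; m*n≢0; +-mono-≤; +-monoˡ-≤; *-mono-≤; *-monoˡ-≤; *-monoʳ-≤; *-mono-<; ^-monoʳ-≤; ^-distribˡ-+-*; module ≤-Reasoning)
open import Data.Nat.DivMod using (m≡m%n+[m/n]*n; m%n<n; m/n*n≤m; m≥n⇒m/n>0)
open import Data.Nat.Tactic.RingSolver using (solve; solve-∀)
open import Data.Product as Product using (Σ; ∃-syntax; _×_; _,_; proj₁; proj₂; uncurry)
open import Data.Product.Function.NonDependent.Propositional using (_×-↔_)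
open import Data.Product.Properties using (≡-dec)
open import Data.Sum using (inj₁; inj₂)
open import Function using (_∘_; id; _↔_; Inverse; Injection)
open import Function.Properties.Inverse using (↔⇒↣; ↔-sym; ↔-refl; ↔-trans)
open import Relation.Binary.Construct.Closure.ReflexiveTransitive using (Star; ε; _◅_; _◅◅_; gmap; reverse)
open import Relation.Binary.Definitions using (Decidable; DecidableEquality)
open import Relation.Binary.PropositionalEquality using (_≡_; _≢_; refl; sym; trans; cong; cong₂; subst; module ≡-Reasoning)
open import Relation.Nullary using (¬_; Dec; yes; no; contradiction)
open import Relation.Nullary.Decidable using (map′; _×-dec_; _⊎-dec_)

-- Complete binary trees

data Node : ℕ → Set where
  root : ∀ {h} → Node h
  sub  : ∀ {h} → Bool → Node h → Node (suc h)

data IsLeaf : ∀ {h} → Node h → Set where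
  leaf-root : IsLeaf {0} root
  leaf-sub  : ∀ {h b} {x : Node h} → IsLeaf x → IsLeaf (sub b x)

infix 4 _⋖_ _≼_ _⋖?_ _≼?_ _≟ₙ_

data _⋖_ : ∀ {h} → Node h → Node h → Set where
  root⋖ : ∀ {h b} → root {suc h} ⋖ sub b root
  sub⋖  : ∀ {h b} {x y : Node h} → x ⋖ y → sub b x ⋖ sub b y

data _≼_ : ∀ {h} → Node h → Node h → Set where
  root≼ : ∀ {h} {y : Node h} → root ≼ y
  sub≼  : ∀ {h b} {x y : Node h} → x ≼ y → sub b x ≼ sub b y

sub-injective : ∀ {h b c} {x y : Node h} → sub b x ≡ sub c y → b ≡ c × x ≡ y
sub-injective refl = refl , refl

_≟ₙ_ : ∀ {h} → DecidableEquality (Node h)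
root    ≟ₙ root    = yes refl
root    ≟ₙ sub _ _ = no λ ()
sub _ _ ≟ₙ root    = no λ ()
sub b x ≟ₙ sub c y = map′ (uncurry (cong₂ sub)) sub-injective (b Bool.≟ c ×-dec x ≟ₙ y)

isLeaf? : ∀ {h} (x : Node h) → Dec (IsLeaf x)
isLeaf? {zero}  root      = yes leaf-root
isLeaf? {suc h} root      = no λ ()
isLeaf?         (sub b x) = map′ leaf-sub (λ { (leaf-sub x-leaf) → x-leaf }) (isLeaf? x)

_⋖?_ : ∀ {h} → Decidable (_⋖_ {h})
root    ⋖? root    = no λ ()
root    ⋖? sub b y = map′ (λ { refl → root⋖ }) (λ { root⋖ → refl }) (y ≟ₙ root)
sub b x ⋖? root    = no λ ()
sub b x ⋖? sub c y =
  map′ (λ { (refl , x⋖y) → sub⋖ x⋖y }) (λ { (sub⋖ x⋖y) → refl , x⋖y }) (b Bool.≟ c ×-dec x ⋖? y)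

_≼?_ : ∀ {h} → Decidable (_≼_ {h})
root    ≼? y       = yes root≼
sub b x ≼? root    = no λ ()
sub b x ≼? sub c y =
  map′ (λ { (refl , x≼y) → sub≼ x≼y }) (λ { (sub≼ x≼y) → refl , x≼y }) (b Bool.≟ c ×-dec x ≼? y)

leaf-≼⇒≡ : ∀ {h} {x y : Node h} → IsLeaf x → x ≼ y → x ≡ y
leaf-≼⇒≡ {y = root} leaf-root         root≼      = refl
leaf-≼⇒≡            (leaf-sub x-leaf) (sub≼ x≼y) = cong (sub _) (leaf-≼⇒≡ x-leaf x≼y)

PathStep : ∀ {h} → Node h → Node h → Node h → Set
PathStep ℓ x y = x ⋖ y × y ≼ ℓ

descent : ∀ {h} (ℓ : Node h) → Star (PathStep ℓ) root ℓ
descent root      = ε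
descent (sub b ℓ) = (root⋖ , sub≼ root≼) ◅ gmap (sub b) (Product.map sub⋖ sub≼) (descent ℓ)

-- Deleting these arcs from an out-tree leaves ℓ as the only leaf reachable from the root.
offPath : ∀ {h} → Node h → List (Node h × Node h)
offPath root      = []
offPath (sub b ℓ) = (root , sub (not b) root) ∷ map (Product.map (sub b) (sub b)) (offPath ℓ)

∈-offPath⁻ : ∀ {h} {ℓ x y : Node h} → (x , y) ∈ offPath ℓ → x ⋖ y × ¬ y ≼ ℓ
∈-offPath⁻ {ℓ = sub false ℓ} (here refl) = root⋖ , λ ()
∈-offPath⁻ {ℓ = sub true ℓ}  (here refl) = root⋖ , λ ()
∈-offPath⁻ {ℓ = sub b ℓ}     (there xy∈) with ∈-map⁻ (Product.map (sub b) (sub b)) xy∈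
... | _ , xy∈′ , refl = Product.map sub⋖ (λ y⋠ℓ → λ { (sub≼ y≼ℓ) → y⋠ℓ y≼ℓ }) (∈-offPath⁻ xy∈′)

∈-offPath⁺ : ∀ {h} {ℓ x y : Node h} → IsLeaf ℓ → x ⋖ y → x ≼ ℓ → ¬ y ≼ ℓ → (x , y) ∈ offPath ℓ
∈-offPath⁺ (leaf-sub {b = false} _) (root⋖ {b = true})  _ _   = here refl
∈-offPath⁺ (leaf-sub {b = true}  _) (root⋖ {b = false}) _ _   = here refl
∈-offPath⁺ (leaf-sub {b = false} _) (root⋖ {b = false}) _ y⋠ℓ = contradiction (sub≼ root≼) y⋠ℓ
∈-offPath⁺ (leaf-sub {b = true}  _) (root⋖ {b = true})  _ y⋠ℓ = contradiction (sub≼ root≼) y⋠ℓ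
∈-offPath⁺ (leaf-sub ℓ-leaf) (sub⋖ x⋖y) (sub≼ x≼ℓ) y⋠ℓ =
  there (∈-map⁺ _ (∈-offPath⁺ ℓ-leaf x⋖y x≼ℓ (y⋠ℓ ∘ sub≼)))

length-offPath : ∀ {h} (ℓ : Node h) → length (offPath ℓ) ≤ h
length-offPath root      = z≤n
length-offPath (sub b ℓ) =
  s≤s (≤-trans (≤-reflexive (length-map (Product.map (sub b) (sub b)) (offPath ℓ))) (length-offPath ℓ))

bit : Bool → Fin 2
bit = Inverse.from 2↔Bool

bit-injective : ∀ {b c} → bit b ≡ bit c → b ≡ c
bit-injective = Injection.injective (↔⇒↣ (↔-sym 2↔Bool))

nodeCount : ℕ → ℕ
nodeCount zero    = 1
nodeCount (suc h) = suc (2 * nodeCount h)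

instance
  nodeCount≢0 : ∀ {h} → NonZero (nodeCount h)
  nodeCount≢0 {zero}  = _
  nodeCount≢0 {suc h} = _

encode : ∀ {h} → Node h → Fin (nodeCount h)
encode {zero}  root      = zero
encode {suc h} root      = zero
encode {suc h} (sub b x) = suc (combine (bit b) (encode x))

encode-injective : ∀ {h} {x y : Node h} → encode x ≡ encode y → x ≡ y
encode-injective {zero}  {root}    {root}    _  = refl
encode-injective {suc h} {root}    {root}    _  = refl
encode-injective {suc h} {sub b x} {sub c y} eq
  with combine-injective (bit b) (encode x) (bit c) (encode y) (suc-injective eq)
... | b≡c , x≡y = cong₂ sub (bit-injective b≡c) (encode-injective x≡y)

booleans : List Bool
booleans = false ∷ true ∷ []

∈-booleans : ∀ b → b ∈ booleans
∈-booleans false = here refl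
∈-booleans true  = there (here refl)

allNodes : ∀ h → List (Node h)
allNodes zero    = root ∷ []
allNodes (suc h) = root ∷ cartesianProductWith sub booleans (allNodes h)

∈-allNodes : ∀ {h} (x : Node h) → x ∈ allNodes h
∈-allNodes {zero}  root      = here refl
∈-allNodes {suc h} root      = here refl
∈-allNodes         (sub b x) = there (∈-cartesianProductWith⁺ sub {xs = booleans} (∈-booleans b) (∈-allNodes x))

leaf : ∀ h → Fin (2 ^ h) → Node h
leaf zero    _ = root
leaf (suc h) i = sub (Inverse.to 2↔Bool (quotient (2 ^ h) i)) (leaf h (remainder {2} (2 ^ h) i))

leaf-isLeaf : ∀ h i → IsLeaf (leaf h i)
leaf-isLeaf zero    _ = leaf-root
leaf-isLeaf (suc h) i = leaf-sub (leaf-isLeaf h _)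

leaf-injective : ∀ h {i j} → leaf h i ≡ leaf h j → i ≡ j
leaf-injective zero    {zero} {zero} _ = refl
leaf-injective (suc h) eq with sub-injective eq
... | b≡c , x≡y = Injection.injective (↔⇒↣ *↔×)
  (cong₂ _,_ (Injection.injective (↔⇒↣ 2↔Bool) b≡c) (leaf-injective h x≡y))

injective⇒≤length : ∀ {A : Set} {N} {xs : List A} (f : Fin N → A) →
  (∀ {i j} → f i ≡ f j → i ≡ j) → (∀ i → f i ∈ xs) → N ≤ length xs
injective⇒≤length {xs = xs} f f-injective f∈xs = injective⇒≤ λ {i} {j} eq → f-injective
  (trans (lookup-index (f∈xs i)) (trans (cong (lookup xs) eq) (sym (lookup-index (f∈xs j)))))

-- Digraphs presented by an arc relation

Reach-invariant : ∀ {n} {G : Digraph n} {F} (P : Fin n → Set) →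
  (∀ {x y} → (x , y) ∈ edges G → (x , y) ∉ F → P x → P y) →
  ∀ {x y} → Reach G F x y → P x → P y
Reach-invariant P closed here                = id
Reach-invariant P closed (step xw∈G xw∉F w⇝y) = Reach-invariant P closed w⇝y ∘ closed xw∈G xw∉F

_≟ₑ_ : ∀ {n} → DecidableEquality (Edge n)
_≟ₑ_ = ≡-dec _≟_ _≟_

-- Vertices of Fin n outside the image of enc are isolated.
module Presentation {V : Set} {n : ℕ}
    (enc : V → Fin n) (enc-injective : ∀ {u v} → enc u ≡ enc v → u ≡ v)
    (vertices : List V) (∈-vertices : ∀ v → v ∈ vertices)
    (_⟶_ : V → V → Set) (_⟶?_ : Decidable _⟶_) where

  encodeArc : V × V → Edge n
  encodeArc = Product.map enc enc

  encodeArc-injective : ∀ {p q} → encodeArc p ≡ encodeArc q → p ≡ q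
  encodeArc-injective eq = cong₂ _,_ (enc-injective (cong proj₁ eq)) (enc-injective (cong proj₂ eq))

  encodeArcs : List (V × V) → List (Edge n)
  encodeArcs ps = deduplicate _≟ₑ_ (map encodeArc ps)

  ∈-encodeArcs⁺ : ∀ {p ps} → p ∈ ps → encodeArc p ∈ encodeArcs ps
  ∈-encodeArcs⁺ = ∈-deduplicate⁺ _≟ₑ_ ∘ ∈-map⁺ encodeArc

  ∈-encodeArcs⁻ : ∀ {e ps} → e ∈ encodeArcs ps → ∃[ p ] (p ∈ ps × e ≡ encodeArc p)
  ∈-encodeArcs⁻ {ps = ps} = ∈-map⁻ encodeArc ∘ ∈-deduplicate⁻ _≟ₑ_ (map encodeArc ps)

  ∉-encodeArcs : ∀ {p ps} → p ∉ ps → encodeArc p ∉ encodeArcs ps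
  ∉-encodeArcs {ps = ps} p∉ps e∈ with ∈-encodeArcs⁻ e∈
  ... | q , q∈ps , eq = p∉ps (subst (_∈ ps) (sym (encodeArc-injective eq)) q∈ps)

  arcs : List (V × V)
  arcs = filter (uncurry _⟶?_) (cartesianProduct vertices vertices)

  graph : Digraph n
  graph = digraph (encodeArcs arcs) (deduplicate-! _≟ₑ_ (map encodeArc arcs))

  ∈-graph⁺ : ∀ {u v} → u ⟶ v → encodeArc (u , v) ∈ edges graph
  ∈-graph⁺ {u} {v} u⟶v =
    ∈-encodeArcs⁺ (∈-filter⁺ (uncurry _⟶?_) (∈-cartesianProduct⁺ (∈-vertices u) (∈-vertices v)) u⟶v)

  ∈-graph⁻ : ∀ {e} → e ∈ edges graph → ∃[ p ] (uncurry _⟶_ p × e ≡ encodeArc p)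
  ∈-graph⁻ e∈G with ∈-encodeArcs⁻ e∈G
  ... | p , p∈arcs , eq =
    p , proj₂ (∈-filter⁻ (uncurry _⟶?_) {xs = cartesianProduct vertices vertices} p∈arcs) , eq

  faultSetOf : ∀ {k} (ps : List (V × V)) → (∀ {u v} → (u , v) ∈ ps → u ⟶ v) → length ps ≤ k →
    FaultSet graph k
  faultSetOf ps ps⊆arcs ps≤k = faultSet (encodeArcs ps) (deduplicate-! _≟ₑ_ (map encodeArc ps))
    (All.tabulate λ e∈ → let (p , p∈ps , eq) = ∈-encodeArcs⁻ e∈ in
      subst (_∈ edges graph) (sym eq) (∈-graph⁺ (ps⊆arcs p∈ps)))
    (≤-trans (length-deduplicate _≟ₑ_ (map encodeArc ps)) (≤-trans (≤-reflexive (length-map encodeArc ps)) ps≤k))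

  ArcAvoiding : List (V × V) → V → V → Set
  ArcAvoiding ps u v = u ⟶ v × (u , v) ∉ ps

  reach⁺ : ∀ {ps u v} → Star (ArcAvoiding ps) u v → Reach graph (encodeArcs ps) (enc u) (enc v)
  reach⁺ ε                  = here
  reach⁺ ((u⟶w , uw∉ps) ◅ w⇝v) = step (∈-graph⁺ u⟶w) (∉-encodeArcs uw∉ps) (reach⁺ w⇝v)

  OnlyExit : List (V × V) → V × V → (V → Set) → Set
  OnlyExit ps e P = ∀ {u v} → u ⟶ v → (u , v) ∉ ps → (u , v) ≢ e → P u → P v

  Image : (V → Set) → Fin n → Set
  Image P x = ∃[ v ] (enc v ≡ x × P v)

  Image-enc : ∀ {P : V → Set} {v} → Image P (enc v) → P v
  Image-enc {P} (_ , eq , Pv′) = subst P (enc-injective eq) Pv′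

  Image-closed : ∀ {ps e P} → OnlyExit ps e P → ∀ {H} → H ⊑ graph → encodeArc e ∉ edges H →
    ∀ {x y} → (x , y) ∈ edges H → (x , y) ∉ encodeArcs ps → Image P x → Image P y
  Image-closed only-exit {H} H⊑G e∉H xy∈H xy∉F (u , refl , Pu) with ∈-graph⁻ (All.lookup H⊑G xy∈H)
  ... | (u′ , v) , u′⟶v , eq with enc-injective (cong proj₁ eq) | cong proj₂ eq
  ... | refl | refl = v , refl , only-exit u′⟶v (xy∉F ∘ ∈-encodeArcs⁺)
    (λ uv≡e → e∉H (subst (λ p → encodeArc p ∈ edges H) uv≡e xy∈H)) Pu

  only-exit-∈ : ∀ {ps e s t} {P : V → Set} → OnlyExit ps e P → P s → ¬ P t →
    ∀ {H} → H ⊑ graph → Reach H (encodeArcs ps) (enc s) (enc t) → encodeArc e ∈ edges H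
  only-exit-∈ {ps} {e} {s} {P = P} only-exit Ps ¬Pt {H} H⊑G s⇝t with _∈?_ _≟ₑ_ (encodeArc e) (edges H)
  ... | yes e∈H = e∈H
  ... | no  e∉H = contradiction
    (Image-enc (Reach-invariant (Image P) (Image-closed {ps} {e} {P} only-exit {H} H⊑G e∉H) s⇝t (s , refl , Ps))) ¬Pt

-- The lower-bound digraph

pattern outward = false
pattern inward  = true

module Construction (h m′ n : ℕ) (fits : suc m′ * (2 * nodeCount h) ≤ n) where

  Vertex : Set
  Vertex = Fin (suc m′) × Bool × Node h

  infix 4 _⟶_ _⟶?_

  data _⟶_ : Vertex → Vertex → Set where
    out-arc  : ∀ {g x y} → x ⋖ y → (g , outward , x) ⟶ (g , outward , y)
    in-arc   : ∀ {g x y} → x ⋖ y → (g , inward , y) ⟶ (g , inward , x)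
    leaf-arc : ∀ {g x y} → IsLeaf x → IsLeaf y → (g , outward , x) ⟶ (g , inward , y)
    next-arc : ∀ {g g′} → suc (toℕ g) ≡ toℕ g′ → (g , inward , root) ⟶ (g′ , outward , root)
    back-arc : (fromℕ m′ , inward , root) ⟶ (zero , outward , root)

  _⟶?_ : Decidable _⟶_
  (g , outward , x) ⟶? (g′ , outward , y) = map′
    (λ { (refl , x⋖y) → out-arc x⋖y }) (λ { (out-arc x⋖y) → refl , x⋖y }) (g ≟ g′ ×-dec x ⋖? y)
  (g , inward , y) ⟶? (g′ , inward , x) = map′
    (λ { (refl , x⋖y) → in-arc x⋖y }) (λ { (in-arc x⋖y) → refl , x⋖y }) (g ≟ g′ ×-dec x ⋖? y)
  (g , outward , x) ⟶? (g′ , inward , y) = map′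
    (λ { (refl , x-leaf , y-leaf) → leaf-arc x-leaf y-leaf })
    (λ { (leaf-arc x-leaf y-leaf) → refl , x-leaf , y-leaf })
    (g ≟ g′ ×-dec isLeaf? x ×-dec isLeaf? y)
  (g , inward , x) ⟶? (g′ , outward , y) = map′
    (λ { (refl , refl , inj₁ g+1≡g′) → next-arc g+1≡g′ ; (refl , refl , inj₂ (refl , refl)) → back-arc })
    (λ { (next-arc g+1≡g′) → refl , refl , inj₁ g+1≡g′ ; back-arc → refl , refl , inj₂ (refl , refl) })
    (x ≟ₙ root ×-dec y ≟ₙ root ×-dec (suc (toℕ g) ℕ.≟ toℕ g′ ⊎-dec (g ≟ fromℕ m′ ×-dec g′ ≟ zero)))

  vertices : List Vertex
  vertices = cartesianProduct (allFin (suc m′)) (cartesianProduct booleans (allNodes h))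

  ∈-vertices : ∀ v → v ∈ vertices
  ∈-vertices (g , b , x) = ∈-cartesianProduct⁺ (∈-allFin g) (∈-cartesianProduct⁺ (∈-booleans b) (∈-allNodes x))

  encodeVertex : Vertex → Fin (suc m′ * (2 * nodeCount h))
  encodeVertex (g , b , x) = combine g (combine (bit b) (encode x))

  enc : Vertex → Fin n
  enc v = inject≤ (encodeVertex v) fits

  enc-injective : ∀ {u v} → enc u ≡ enc v → u ≡ v
  enc-injective {g , b , x} {g′ , b′ , x′} eq
    with combine-injective g _ g′ _ (inject≤-injective fits fits _ _ eq)
  ... | refl , eq′ with combine-injective (bit b) (encode x) (bit b′) (encode x′) eq′
  ... | b≡b′ , x≡x′ = cong₂ (λ b x → g , b , x) (bit-injective b≡b′) (encode-injective x≡x′)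

  open Presentation enc enc-injective vertices ∈-vertices _⟶_ _⟶?_ public

  source sink : Vertex
  source = zero , outward , root
  sink   = fromℕ m′ , inward , root

  module Cut (g₀ : Fin (suc m′)) (a b : Fin (2 ^ h)) where

    ℓ r : Node h
    ℓ = leaf h a
    r = leaf h b

    outArc inArc : Node h × Node h → Vertex × Vertex
    outArc (x , y) = (g₀ , outward , x) , (g₀ , outward , y)
    inArc  (x , y) = (g₀ , inward , y) , (g₀ , inward , x)

    faults : List (Vertex × Vertex)
    faults = map outArc (offPath ℓ) ++ map inArc (offPath r)

    critical : Vertex × Vertex
    critical = (g₀ , outward , ℓ) , (g₀ , inward , r)

    data Fault : Vertex → Vertex → Set where
      out-fault : ∀ {x y} → x ⋖ y → ¬ y ≼ ℓ → Fault (g₀ , outward , x) (g₀ , outward , y)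
      in-fault  : ∀ {x y} → x ⋖ y → ¬ y ≼ r → Fault (g₀ , inward , y) (g₀ , inward , x)

    ∈-faults⁻ : ∀ {u v} → (u , v) ∈ faults → Fault u v
    ∈-faults⁻ uv∈ with ∈-++⁻ (map outArc (offPath ℓ)) uv∈
    ... | inj₁ uv∈out with ∈-map⁻ outArc uv∈out
    ...   | _ , xy∈ , refl = uncurry out-fault (∈-offPath⁻ xy∈)
    ∈-faults⁻ uv∈ | inj₂ uv∈in with ∈-map⁻ inArc uv∈in
    ...   | _ , xy∈ , refl = uncurry in-fault (∈-offPath⁻ xy∈)

    out-fault-∈ : ∀ {x y} → x ⋖ y → x ≼ ℓ → ¬ y ≼ ℓ → outArc (x , y) ∈ faults
    out-fault-∈ x⋖y x≼ℓ y⋠ℓ = ∈-++⁺ˡ (∈-map⁺ outArc (∈-offPath⁺ (leaf-isLeaf h a) x⋖y x≼ℓ y⋠ℓ))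

    in-fault-∈ : ∀ {x y} → x ⋖ y → x ≼ r → ¬ y ≼ r → inArc (x , y) ∈ faults
    in-fault-∈ x⋖y x≼r y⋠r =
      ∈-++⁺ʳ (map outArc (offPath ℓ)) (∈-map⁺ inArc (∈-offPath⁺ (leaf-isLeaf h b) x⋖y x≼r y⋠r))

    faults⊆arcs : ∀ {u v} → (u , v) ∈ faults → u ⟶ v
    faults⊆arcs uv∈ with ∈-faults⁻ uv∈
    ... | out-fault x⋖y _ = out-arc x⋖y
    ... | in-fault  x⋖y _ = in-arc x⋖y

    length-faults : length faults ≤ h + h
    length-faults = begin
      length faults
        ≡⟨ length-++ (map outArc (offPath ℓ)) ⟩
      length (map outArc (offPath ℓ)) + length (map inArc (offPath r))
        ≡⟨ cong₂ _+_ (length-map outArc (offPath ℓ)) (length-map inArc (offPath r)) ⟩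
      length (offPath ℓ) + length (offPath r)
        ≤⟨ +-mono-≤ (length-offPath ℓ) (length-offPath r) ⟩
      h + h ∎
      where open ≤-Reasoning

    ∉-faults : ∀ {u v} → ¬ Fault u v → (u , v) ∉ faults
    ∉-faults ¬fault = ¬fault ∘ ∈-faults⁻

    block-walk : ∀ g → Star (ArcAvoiding faults) (g , outward , root) (g , inward , root)
    block-walk g =
      gmap (λ x → g , outward , x) (λ (x⋖y , y≼ℓ) → out-arc x⋖y , ∉-faults λ { (out-fault _ y⋠ℓ) → y⋠ℓ y≼ℓ })
        (descent ℓ) ◅◅
      (leaf-arc (leaf-isLeaf h a) (leaf-isLeaf h b) , ∉-faults λ ()) ◅
      gmap (λ x → g , inward , x) (λ (x⋖y , y≼r) → in-arc x⋖y , ∉-faults λ { (in-fault _ y⋠r) → y⋠r y≼r })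
        (reverse id (descent r))

    source⇝in-root : ∀ j (j<m : j < suc m′) → Star (ArcAvoiding faults) source (fromℕ< j<m , inward , root)
    source⇝in-root zero    _     = block-walk zero
    source⇝in-root (suc j) j+1<m =
      source⇝in-root j j<m ◅◅ (next-arc g+1≡g′ , ∉-faults λ ()) ◅ block-walk (fromℕ< j+1<m)
      where
      j<m : j < suc m′
      j<m = <⇒≤ j+1<m
      g+1≡g′ : suc (toℕ (fromℕ< j<m)) ≡ toℕ (fromℕ< j+1<m)
      g+1≡g′ = trans (cong suc (toℕ-fromℕ< j<m)) (sym (toℕ-fromℕ< j+1<m))

    source⇝sink : Star (ArcAvoiding faults) source sink
    source⇝sink = subst (λ g → Star (ArcAvoiding faults) source (g , inward , root))
      (sym (fromℕ-def m′)) (source⇝in-root m′ ≤-refl)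

    sink⇝source : Star (ArcAvoiding faults) sink source
    sink⇝source = (back-arc , ∉-faults λ ()) ◅ ε

    data SourceSide : Vertex → Set where
      earlier    : ∀ {g b x} → g Fin.< g₀ → SourceSide (g , b , x)
      on-ℓ-path  : ∀ {g x} → g ≡ g₀ → x ≼ ℓ → SourceSide (g , outward , x)
      off-r-path : ∀ {g x} → g ≡ g₀ → ¬ x ≼ r → SourceSide (g , inward , x)

    source-side : SourceSide source
    source-side with zero ≟ g₀
    ... | yes 0≡g₀ = on-ℓ-path 0≡g₀ root≼
    ... | no  0≢g₀ = earlier (≤∧≢⇒< z≤n 0≢g₀)

    sink-side : ¬ SourceSide sink
    sink-side (earlier last<g₀)     = <⇒≱ last<g₀ (≤fromℕ g₀)
    sink-side (off-r-path _ root⋠r) = root⋠r root≼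

    critical-only-exit : OnlyExit faults critical SourceSide
    critical-only-exit (out-arc _) _ _ (earlier g<g₀) = earlier g<g₀
    critical-only-exit (out-arc {y = y} x⋖y) uv∉F _ (on-ℓ-path refl x≼ℓ) with y ≼? ℓ
    ... | yes y≼ℓ = on-ℓ-path refl y≼ℓ
    ... | no  y⋠ℓ = contradiction (out-fault-∈ x⋖y x≼ℓ y⋠ℓ) uv∉F
    critical-only-exit (in-arc _) _ _ (earlier g<g₀) = earlier g<g₀
    critical-only-exit (in-arc x⋖y) uv∉F _ (off-r-path refl y⋠r) =
      off-r-path refl λ x≼r → uv∉F (in-fault-∈ x⋖y x≼r y⋠r)
    critical-only-exit (leaf-arc _ _) _ _ (earlier g<g₀) = earlier g<g₀
    critical-only-exit (leaf-arc x-leaf y-leaf) _ uv≢critical (on-ℓ-path refl x≼ℓ) =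
      off-r-path refl λ y≼r → uv≢critical
        (cong₂ (λ x y → (g₀ , outward , x) , (g₀ , inward , y)) (leaf-≼⇒≡ x-leaf x≼ℓ) (leaf-≼⇒≡ y-leaf y≼r))
    critical-only-exit (next-arc g+1≡g′) _ _ (earlier g<g₀)
      with m≤n⇒m<n∨m≡n (subst (ℕ._≤ toℕ g₀) g+1≡g′ g<g₀)
    ... | inj₁ g′<g₀ = earlier g′<g₀
    ... | inj₂ g′≡g₀ = on-ℓ-path (toℕ-injective g′≡g₀) root≼
    critical-only-exit (next-arc _) _ _ (off-r-path _ root⋠r) = contradiction root≼ root⋠r
    critical-only-exit back-arc     _ _ (earlier last<g₀)     = contradiction (≤fromℕ g₀) (<⇒≱ last<g₀)
    critical-only-exit back-arc     _ _ (off-r-path _ root⋠r) = contradiction root≼ root⋠r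

  criticalEdge : Fin (suc m′) × Fin (2 ^ h) × Fin (2 ^ h) → Edge n
  criticalEdge (g , a , b) = encodeArc (Cut.critical g a b)

  criticalEdge-injective : ∀ {p q} → criticalEdge p ≡ criticalEdge q → p ≡ q
  criticalEdge-injective {g , a , b} {g′ , a′ , b′} eq = cong₂ _,_ (cong (proj₁ ∘ proj₁) crit≡)
    (cong₂ _,_ (leaf-injective h (cong (proj₂ ∘ proj₂ ∘ proj₁) crit≡))
               (leaf-injective h (cong (proj₂ ∘ proj₂ ∘ proj₂) crit≡)))
    where
    crit≡ : Cut.critical g a b ≡ Cut.critical g′ a′ b′
    crit≡ = encodeArc-injective eq

  critical-arc-∈ : ∀ {k} → h + h ≤ k → ∀ {H} → FTPreserver k graph (enc source) (enc sink) H →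
    ∀ p → criticalEdge p ∈ edges H
  critical-arc-∈ h+h≤k {H} (H⊑G , preserves) (g , a , b) =
    only-exit-∈ {P = SourceSide} critical-only-exit source-side sink-side {H} H⊑G
      (proj₁ (proj₂ (preserves F) (reach⁺ source⇝sink , reach⁺ sink⇝source)))
    where
    open Cut g a b
    F : FaultSet graph _
    F = faultSetOf faults faults⊆arcs (≤-trans length-faults h+h≤k)

  blocks×leaves² : Fin (suc m′ * (2 ^ h * 2 ^ h)) ↔ (Fin (suc m′) × Fin (2 ^ h) × Fin (2 ^ h))
  blocks×leaves² = ↔-trans *↔× (↔-refl ×-↔ *↔×)

  preserver-size : ∀ {k} → h + h ≤ k → (H : Digraph n) → FTPreserver k graph (enc source) (enc sink) H →
    suc m′ * (2 ^ h * 2 ^ h) ≤ ∣E∣ H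
  preserver-size h+h≤k H preserver = injective⇒≤length (criticalEdge ∘ Inverse.to blocks×leaves²)
    (Injection.injective (↔⇒↣ blocks×leaves²) ∘ criticalEdge-injective)
    (critical-arc-∈ h+h≤k preserver ∘ Inverse.to blocks×leaves²)

-- Choice of the parameters

suc-nodeCount : ∀ h → suc (nodeCount h) ≡ 2 ^ suc h
suc-nodeCount zero    = refl
suc-nodeCount (suc h) = begin
  suc (suc (2 * nodeCount h)) ≡⟨ *-suc 2 (nodeCount h) ⟨
  2 * suc (nodeCount h)       ≡⟨ cong (2 *_) (suc-nodeCount h) ⟩
  2 * 2 ^ suc h               ∎
  where open ≡-Reasoning

block-size≤ : ∀ h → 2 * nodeCount h ≤ 2 ^ suc (suc h)
block-size≤ h = *-monoʳ-≤ 2 (≤-trans (n≤1+n (nodeCount h)) (≤-reflexive (suc-nodeCount h)))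

m*m≤n*n⇒m≤n : ∀ {m n} → m * m ≤ n * n → m ≤ n
m*m≤n*n⇒m≤n m*m≤n*n = ≮⇒≥ λ n<m → <⇒≱ (*-mono-< n<m n<m) m*m≤n*n

halving : ∀ k → ∃[ j ] (j + j ≤ k × k ≤ suc (j + j))
halving zero          = 0 , z≤n , z≤n
halving (suc zero)    = 0 , z≤n , s≤s z≤n
halving (suc (suc k)) with halving k
... | j , j+j≤k , k≤1+j+j = suc j
  , subst (_≤ suc (suc k)) (cong suc (sym (+-suc j j))) (s≤s (s≤s j+j≤k))
  , subst (λ i → suc (suc k) ≤ suc (suc i)) (sym (+-suc j j)) (s≤s (s≤s k≤1+j+j))

height-from-half : ∀ {n k} j → j + j ≤ k → 2 ^ k ≤ 2 * (2 ^ j * 2 ^ j) → 2 ≤ n → 2 ^ j ≤ n →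
  ∃[ h ] (h + h ≤ k × 2 * nodeCount h ≤ n × 2 ^ k ≤ 32 * (2 ^ h * 2 ^ h))
height-from-half 0 _ 2^k≤2 2≤n _ = 0 , z≤n , 2≤n , ≤-trans 2^k≤2 (m≤m+n 2 30)
height-from-half 1 _ 2^k≤8 2≤n _ = 0 , z≤n , 2≤n , ≤-trans 2^k≤8 (m≤m+n 8 24)
height-from-half {k = k} (suc (suc h)) j+j≤k 2^k≤2[2^j]² _ 2^j≤n =
  h , ≤-trans (+-mono-≤ (m≤n+m h 2) (m≤n+m h 2)) j+j≤k , ≤-trans (block-size≤ h) 2^j≤n , (begin
    2 ^ k                                           ≤⟨ 2^k≤2[2^j]² ⟩
    2 * ((2 * (2 * 2 ^ h)) * (2 * (2 * 2 ^ h)))     ≡⟨ 2[4d]²≡32d² (2 ^ h) ⟩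
    32 * (2 ^ h * 2 ^ h)                            ∎)
  where
  open ≤-Reasoning
  2[4d]²≡32d² : ∀ d → 2 * ((2 * (2 * d)) * (2 * (2 * d))) ≡ 32 * (d * d)
  2[4d]²≡32d² = solve-∀

choose-height : ∀ {n k} → 1 ≤ k → 2 ^ k ≤ n * n →
  ∃[ h ] (h + h ≤ k × 2 * nodeCount h ≤ n × 2 ^ k ≤ 32 * (2 ^ h * 2 ^ h))
choose-height {n} {k} 1≤k 2^k≤n*n with halving k
... | j , j+j≤k , k≤1+j+j = height-from-half j j+j≤k 2^k≤2[2^j]² 2≤n 2^j≤n
  where
  2^k≤2[2^j]² : 2 ^ k ≤ 2 * (2 ^ j * 2 ^ j)
  2^k≤2[2^j]² = ≤-trans (^-monoʳ-≤ 2 k≤1+j+j) (≤-reflexive (cong (2 *_) (^-distribˡ-+-* 2 j j)))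
  2^j≤n : 2 ^ j ≤ n
  2^j≤n = m*m≤n*n⇒m≤n
    (≤-trans (≤-reflexive (sym (^-distribˡ-+-* 2 j j))) (≤-trans (^-monoʳ-≤ 2 j+j≤k) 2^k≤n*n))
  2≤n : 2 ≤ n
  2≤n = ≰⇒> λ n≤1 → <⇒≱ (≤-trans (^-monoʳ-≤ 2 1≤k) 2^k≤n*n) (*-mono-≤ n≤1 n≤1)

choose-blocks : ∀ {n B} .{{_ : NonZero B}} → B ≤ n → ∃[ m′ ] (suc m′ * B ≤ n × n ≤ 2 * (suc m′ * B))
choose-blocks {n} {B} B≤n = positive (n / B) (m≥n⇒m/n>0 B≤n) (m/n*n≤m n B) n≤2[n/B]B
  where
  n≤2[n/B]B : n ≤ 2 * (n / B * B)
  n≤2[n/B]B = begin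
    n                     ≡⟨ m≡m%n+[m/n]*n n B ⟩
    n % B + n / B * B     ≤⟨ +-monoˡ-≤ (n / B * B) (≤-trans (<⇒≤ (m%n<n n B)) B≤n/B*B) ⟩
    n / B * B + n / B * B ≡⟨ cong (n / B * B +_) (+-identityʳ (n / B * B)) ⟨
    2 * (n / B * B)       ∎
    where
    open ≤-Reasoning
    B≤n/B*B : B ≤ n / B * B
    B≤n/B*B = m≤n*m B (n / B) {{>-nonZero (m≥n⇒m/n>0 B≤n)}}
  positive : ∀ q → 0 < q → q * B ≤ n → n ≤ 2 * (q * B) →
    ∃[ m′ ] (suc m′ * B ≤ n × n ≤ 2 * (suc m′ * B))
  positive (suc m′) _ qB≤n n≤2qB = m′ , qB≤n , n≤2qB

size-bound : ∀ n k M D {B E} → 2 ^ k ≤ 32 * (D * D) → n ≤ 2 * (M * B) → B ≤ 2 * (2 * D) → M * (D * D) ≤ E →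
  (n * n) * 2 ^ k ≤ (46 * 46) * (E * E)
size-bound n k M D {B} {E} 2^k≤32D² n≤2MB B≤4D MD²≤E = begin
  (n * n) * 2 ^ k          ≤⟨ *-monoʳ-≤ (n * n) 2^k≤32D² ⟩
  (n * n) * (32 * (D * D)) ≡⟨ solve (n ∷ D ∷ []) ⟩
  32 * ((n * D) * (n * D)) ≤⟨ *-monoʳ-≤ 32 (*-mono-≤ nD≤8E nD≤8E) ⟩
  32 * ((8 * E) * (8 * E)) ≡⟨ solve (E ∷ []) ⟩
  2048 * (E * E)           ≤⟨ *-monoˡ-≤ (E * E) (m≤m+n 2048 68) ⟩
  (46 * 46) * (E * E)      ∎
  where
  open ≤-Reasoning
  nD≤8E : n * D ≤ 8 * E
  nD≤8E = begin
    n * D                       ≤⟨ *-monoˡ-≤ D (≤-trans n≤2MB (*-monoʳ-≤ 2 (*-monoʳ-≤ M B≤4D))) ⟩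
    2 * (M * (2 * (2 * D))) * D ≡⟨ solve (M ∷ D ∷ []) ⟩
    8 * (M * (D * D))           ≤⟨ *-monoʳ-≤ 8 MD²≤E ⟩
    8 * E                       ∎

theoremA5 : ∃[ c ] (1 ≤ c ×
    ((n k : ℕ) → 1 ≤ n → 1 ≤ k → 2 ^ k ≤ n * n →
      ∃[ G ] Σ (Fin n) (λ s → Σ (Fin n) (λ t →
        (H : Digraph n) → FTPreserver k G s t H →
          (n * n) * 2 ^ k ≤ (c * c) * (∣E∣ H * ∣E∣ H)))))
theoremA5 = 46 , s≤s z≤n , lower-bound
  where
  lower-bound : (n k : ℕ) → 1 ≤ n → 1 ≤ k → 2 ^ k ≤ n * n →
    ∃[ G ] Σ (Fin n) (λ s → Σ (Fin n) (λ t →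
      (H : Digraph n) → FTPreserver k G s t H → (n * n) * 2 ^ k ≤ (46 * 46) * (∣E∣ H * ∣E∣ H)))
  -- 1 ≤ n is implied by 1 ≤ k and 2 ^ k ≤ n * n.
  lower-bound n k _ 1≤k 2^k≤n*n with choose-height 1≤k 2^k≤n*n
  ... | h , h+h≤k , block≤n , 2^k≤32D² with choose-blocks {{m*n≢0 2 (nodeCount h)}} block≤n
  ... | m′ , blocks≤n , n≤2blocks = graph , enc source , enc sink , λ H preserver →
    size-bound n k (suc m′) (2 ^ h) 2^k≤32D² n≤2blocks (block-size≤ h) (preserver-size h+h≤k H preserver)
    where open Construction h m′ n blocks≤n
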